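{- Let $(G,L,f_0,f_t)$ be an instance of List Coloring Reconfiguration, and let $H_1,H_2$ be two identical induced subgraphs of $G$. Then the restricted instance $(G\setminus V(H_2),\,L|_{G\setminus V(H_2)},\,f_0|_{G\setminus V(H_2)},\,f_t|_{G\setminus V(H_2)})$ is a yes-instance if and only if $(G,L,f_0,f_t)$ is a yes-instance.
   Context: Graphs are finite and simple. For a color set $C$, a graph $G=(V,E)$ and a list $L\colon V\to 2^C$, an $L$-coloring is a map $f\colon V\to C$ with $f(v)\in L(v)$ for all $v$ and $f(v)\neq f(w)$ for each edge $vw$. Two $L$-colorings are adjacent if they differ on exactly one vertex; the instance $(G,L,f_0,f_t)$ (with $f_0,f_t$ $L$-colorings) is a yes-instance if there is a sequence of $L$-colorings from $f_0$ to $f_t$ in which consecutive ones are adjacent. $|_{H}$ denotes restriction of a map to $V(H)$. The vertex assignment of $v$ is the triple $(L(v),f_0(v),f_t(v))$. Two induced subgraphs $H_1,H_2$ of $G$ with $|V(H_1)|=|V(H_2)|$ and $V(H_1)\cap V(H_2)=\emptyset$ are identical if there is a bijection $\phi\colon V(H_1)\to V(H_2)$ such that (1) $vw\in E(H_1)$ iff $\phi(v)\phi(w)\in E(H_2)$, and (2) for every $v\in V(H_1)$: $N_G(v)\setminus V(H_1)=N_G(\phi(v))\setminus V(H_2)$, and $L(v)=L(\phi(v))$, $f_0(v)=f_0(\phi(v))$, $f_t(v)=f_t(\phi(v))$. -}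

module Defs where

open import Data.Nat using (ℕ)
open import Data.Fin using (Fin)
open import Data.Fin.Subset using (Subset; _∈_; _∉_; ∁)
open import Data.Product using (Σ; ∃; ∃-syntax; _×_; _,_; proj₁)
open import Relation.Binary.PropositionalEquality using (_≡_; _≢_; _≗_)
open import Relation.Binary.Construct.Closure.ReflexiveTransitive using (Star)
open import Function.Bundles using (_⇔_; _↔_; Inverse)

IsLColoring : ∀ {V : Set} {k : ℕ} → (V → V → Set) → (V → Subset k) → (V → Fin k) → Set
IsLColoring {V} E L f = (∀ v → f v ∈ L v) × (∀ v w → E v w → f v ≢ f w)

DifferOnExactlyOne : ∀ {V : Set} {k : ℕ} → (V → Fin k) → (V → Fin k) → Set
DifferOnExactlyOne {V} f g = ∃[ v ] (f v ≢ g v × (∀ w → w ≢ v → f w ≡ g w))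

Step : ∀ {V : Set} {k : ℕ} → (V → V → Set) → (V → Subset k) → (V → Fin k) → (V → Fin k) → Set
Step E L f g = IsLColoring E L f × IsLColoring E L g × DifferOnExactlyOne f g

-- (G,L,f0,ft) is a yes-instance: a sequence of adjacent L-colorings from f0 to ft
-- (maps compared pointwise, since Agda has no function extensionality)
YesInstance : ∀ {V : Set} {k : ℕ} → (V → V → Set) → (V → Subset k) → (V → Fin k) → (V → Fin k) → Set
YesInstance {V} {k} E L f0 ft =
  Σ (V → Fin k) λ g → Σ (V → Fin k) λ h → (f0 ≗ g) × Star (Step E L) g h × (h ≗ ft)

VertexIn : ∀ {n} → Subset n → Set
VertexIn {n} S = Σ (Fin n) (λ v → v ∈ S)

-- Vertices of G ∖ S  (membership in the complement; proofs are proof-irrelevant)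
VertexOutside : ∀ {n} → Subset n → Set
VertexOutside {n} S = Σ (Fin n) (λ v → v ∈ ∁ S)

Identical : ∀ {n k} → (Fin n → Fin n → Set) → (Fin n → Subset k) → (Fin n → Fin k) → (Fin n → Fin k)
          → (S1 S2 : Subset n) → Set
Identical {n} {k} E L f0 ft S1 S2 =
  (∀ v → v ∈ S1 → v ∉ S2) ×
  Σ (VertexIn S1 ↔ VertexIn S2) λ φ →
    let φ⃗ = λ (x : VertexIn S1) → proj₁ (Inverse.to φ x) in
    (∀ x y → (E (proj₁ x) (proj₁ y) ⇔ E (φ⃗ x) (φ⃗ y))) ×
    (∀ x → (∀ w → ((E (proj₁ x) w × w ∉ S1) ⇔ (E (φ⃗ x) w × w ∉ S2)))
         × L (proj₁ x) ≡ L (φ⃗ x)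
         × f0 (proj₁ x) ≡ f0 (φ⃗ x)
         × ft (proj₁ x) ≡ ft (φ⃗ x))

restrictE : ∀ {n} (S : Subset n) → (Fin n → Fin n → Set) → VertexOutside S → VertexOutside S → Set
restrictE S E x y = E (proj₁ x) (proj₁ y)

restrict : ∀ {n} {A : Set} (S : Subset n) → (Fin n → A) → VertexOutside S → A
restrict S f x = f (proj₁ x)

-- Deleting H₂ is undone by folding H₂ back onto H₁: the map sending φ(x) to x and fixing
-- every other vertex is a homomorphism of G onto G ∖ V(H₂) that preserves the vertex
-- assignments, so every reconfiguration step of G ∖ V(H₂) pulls back along it to a
-- sequence of steps of G (recolor the fibre vertex by vertex; each intermediate coloring
-- is a mixture of two colorings one step apart, hence proper).  Conversely a sequence for
-- G restricts to one for G ∖ V(H₂), the steps inside V(H₂) becoming trivial.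
module Submission where

open import Defs
open import Data.Nat using (ℕ)
open import Data.Fin using (Fin; _≟_)
open import Data.Fin.Subset using (Subset; _∈_; _∉_; ∁)
open import Data.Fin.Subset.Properties using (_∈?_; x∉p⇒x∈∁p)
open import Data.Vec.Properties.WithK using ([]=-irrelevant)
open import Data.List using (List; []; _∷_; allFin)
open import Data.List.Relation.Unary.Any using (here; there)
import Data.List.Membership.Propositional as List
open import Data.List.Membership.Propositional.Properties using (∈-allFin)
open import Data.Empty using (⊥; ⊥-elim)
open import Data.Sum using (_⊎_; inj₁; inj₂; [_,_]′)
open import Data.Product using (_×_; _,_; proj₁; proj₂)
open import Function using (_∘_; id)
open import Function.Bundles using (_⇔_; _↔_; Inverse; Equivalence; mk⇔)
open import Relation.Nullary using (¬_; yes; no; Dec)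
open import Relation.Binary.Definitions using (DecidableEquality)
open import Relation.Binary.PropositionalEquality
open import Relation.Binary.Construct.Closure.ReflexiveTransitive using (Star; ε; _◅_; _◅◅_)

Mixture : ∀ {V A : Set} → (V → A) → (V → A) → (V → A) → Set
Mixture g h f = ∀ v → f v ≡ g v ⊎ f v ≡ h v

module _ {V : Set} {k : ℕ} {E : V → V → Set} {L : V → Subset k} where

  IsLColoring-resp-≗ : ∀ {f g} → f ≗ g → IsLColoring E L f → IsLColoring E L g
  IsLColoring-resp-≗ f≗g (f∈L , f-proper) =
    (λ v → subst (_∈ L v) (f≗g v) (f∈L v)) ,
    (λ v w e gv≡gw → f-proper v w e (trans (f≗g v) (trans gv≡gw (sym (f≗g w)))))

  Step-respˡ : ∀ {f g h} → f ≗ g → Step E L g h → Step E L f h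
  Step-respˡ f≗g (g-col , h-col , v , gv≢hv , agree) =
    IsLColoring-resp-≗ (sym ∘ f≗g) g-col , h-col , v ,
    (λ fv≡hv → gv≢hv (trans (sym (f≗g v)) fv≡hv)) ,
    (λ w w≢v → trans (f≗g w) (agree w w≢v))

  Step-sym : ∀ {g h} → Step E L g h → Step E L h g
  Step-sym (g-col , h-col , v , gv≢hv , agree) =
    h-col , g-col , v , gv≢hv ∘ sym , λ w w≢v → sym (agree w w≢v)

  -- The changed vertex x cannot be both a and b, since E is irreflexive; as the goal is
  -- a negation this needs no decidable equality on V.
  Step-≢-across-edge : (∀ v → ¬ E v v) → ∀ {g h} → Step E L g h →
                       ∀ {a b} → E a b → g a ≢ h b
  Step-≢-across-edge E-irr {g} {h} (g-col , h-col , x , _ , agree) {a} {b} e ga≡hb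
    with g a ≟ h a | g b ≟ h b
  ... | yes ga≡ha | _ = proj₂ h-col a b e (trans (sym ga≡ha) ga≡hb)
  ... | _ | yes gb≡hb = proj₂ g-col a b e (trans ga≡hb (sym gb≡hb))
  ... | no ga≢ha | no gb≢hb =
    ga≢ha (agree a λ a≡x → gb≢hb (agree b λ b≡x → E-irr x (subst₂ E a≡x b≡x e)))

  YesInstance-≗ : ∀ {g h} → g ≗ h → YesInstance E L g h
  YesInstance-≗ {g} g≗h = g , g , (λ _ → refl) , ε , g≗h

  Step⇒YesInstance : ∀ {g h} → Step E L g h → YesInstance E L g h
  Step⇒YesInstance {g} {h} s = g , h , (λ _ → refl) , s ◅ ε , (λ _ → refl)

  YesInstance-trans : ∀ {f g h} → YesInstance E L f g → YesInstance E L g h → YesInstance E L f h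
  YesInstance-trans (f′ , g′ , f≗f′ , path , g′≗g) (g″ , h′ , g≗g″ , ε , h′≗h) =
    f′ , g′ , f≗f′ , path , λ v → trans (g′≗g v) (trans (g≗g″ v) (h′≗h v))
  YesInstance-trans (f′ , g′ , f≗f′ , path , g′≗g) (g″ , h′ , g≗g″ , s ◅ path′ , h′≗h) =
    f′ , h′ , f≗f′ , path ◅◅ Step-respˡ (λ v → trans (g′≗g v) (g≗g″ v)) s ◅ path′ , h′≗h

YesInstance-map : ∀ {V W : Set} {k} {E : V → V → Set} {L : V → Subset k}
                  {E′ : W → W → Set} {L′ : W → Subset k}
                  (F : (V → Fin k) → (W → Fin k)) →
                  (∀ {g h} → g ≗ h → F g ≗ F h) →
                  (∀ {g h} → Step E L g h → YesInstance E′ L′ (F g) (F h)) →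
                  ∀ {g h} → YesInstance E L g h → YesInstance E′ L′ (F g) (F h)
YesInstance-map {E = E} {L} {E′} {L′} F F-≗ F-step (g′ , h′ , g≗g′ , path , h′≗h) =
  YesInstance-trans (YesInstance-≗ (F-≗ g≗g′))
    (YesInstance-trans (along path) (YesInstance-≗ (F-≗ h′≗h)))
  where
  along : ∀ {g h} → Star (Step E L) g h → YesInstance E′ L′ (F g) (F h)
  along ε = YesInstance-≗ (λ _ → refl)
  along (s ◅ path) = YesInstance-trans (F-step s) (along path)

module _ {V : Set} (_≟ᵥ_ : DecidableEquality V) {k : ℕ} where

  update : V → (V → Fin k) → (V → Fin k) → V → Fin k
  update u h g w with w ≟ᵥ u
  ... | yes _ = h w
  ... | no _ = g w

  update-≡ : ∀ {u h g w} → w ≡ u → update u h g w ≡ h w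
  update-≡ {u} {w = w} w≡u with w ≟ᵥ u
  ... | yes _ = refl
  ... | no w≢u = ⊥-elim (w≢u w≡u)

  update-≢ : ∀ {u h g w} → w ≢ u → update u h g w ≡ g w
  update-≢ {u} {w = w} w≢u with w ≟ᵥ u
  ... | yes w≡u = ⊥-elim (w≢u w≡u)
  ... | no _ = refl

  update-mixture : ∀ {u g h f} → Mixture g h f → Mixture g h (update u h f)
  update-mixture {u} f-mix w with w ≟ᵥ u
  ... | yes _ = inj₂ refl
  ... | no _ = f-mix w

  overwrite : List V → (V → Fin k) → (V → Fin k) → V → Fin k
  overwrite [] h g = g
  overwrite (u ∷ D) h g = update u h (overwrite D h g)

  overwrite-∈ : ∀ {D h g w} → w List.∈ D → overwrite D h g w ≡ h w
  overwrite-∈ (here w≡u) = update-≡ w≡u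
  overwrite-∈ {u ∷ D} {w = w} (there w∈D) with w ≟ᵥ u
  ... | yes _ = refl
  ... | no _ = overwrite-∈ w∈D

  overwrite-mixture : ∀ D {g h} → Mixture g h (overwrite D h g)
  overwrite-mixture [] _ = inj₁ refl
  overwrite-mixture (_ ∷ D) = update-mixture (overwrite-mixture D)

  module _ {E : V → V → Set} {L : V → Subset k} where

    YesInstance-update : ∀ {u h g} → IsLColoring E L g → IsLColoring E L (update u h g) →
                         YesInstance E L g (update u h g)
    YesInstance-update {u} {h} {g} g-col g′-col with g u ≟ h u
    ... | no gu≢hu = Step⇒YesInstance
      (g-col , g′-col , u , (λ e → gu≢hu (trans e (update-≡ refl))) ,
       λ w w≢u → sym (update-≢ w≢u))
    ... | yes gu≡hu = YesInstance-≗ unchanged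
      where
      unchanged : g ≗ update u h g
      unchanged w with w ≟ᵥ u
      ... | yes refl = gu≡hu
      ... | no _ = refl

    YesInstance-overwrite : ∀ {g h} → (∀ f → Mixture g h f → IsLColoring E L f) →
                            ∀ D → YesInstance E L g (overwrite D h g)
    YesInstance-overwrite proper [] = YesInstance-≗ (λ _ → refl)
    YesInstance-overwrite proper (u ∷ D) =
      YesInstance-trans (YesInstance-overwrite proper D)
        (YesInstance-update (proper _ (overwrite-mixture D))
                            (proper _ (update-mixture (overwrite-mixture D))))

    YesInstance-of-mixtures : ∀ {g h} (D : List V) → (∀ v → g v ≢ h v → v List.∈ D) →
                              (∀ f → Mixture g h f → IsLColoring E L f) →
                              YesInstance E L g h
    YesInstance-of-mixtures {g} {h} D covers proper =
      YesInstance-trans (YesInstance-overwrite proper D) (YesInstance-≗ overwrite≗h)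
      where
      overwrite≗h : overwrite D h g ≗ h
      overwrite≗h v with g v ≟ h v
      ... | no gv≢hv = overwrite-∈ (covers v gv≢hv)
      ... | yes gv≡hv = [ (λ e → trans e gv≡hv) , id ]′ (overwrite-mixture D v)

module _ {V W : Set} {k : ℕ} {E : V → V → Set} {L : V → Subset k}
         {E′ : W → W → Set} {L′ : W → Subset k}
         (r : V → W) (r-edge : ∀ {v w} → E v w → E′ (r v) (r w))
         (r-list : ∀ v → L′ (r v) ≡ L v) (E′-irr : ∀ x → ¬ E′ x x) where

  mixture-IsLColoring : ∀ {g h f} → Step E′ L′ g h → Mixture (g ∘ r) (h ∘ r) f →
                        IsLColoring E L f
  mixture-IsLColoring {g} {h} {f} s@(g-col , h-col , _) f-mix = f∈L , f-proper
    where
    f∈L : ∀ v → f v ∈ L v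
    f∈L v with f-mix v
    ... | inj₁ fv≡g = subst₂ _∈_ (sym fv≡g) (r-list v) (proj₁ g-col (r v))
    ... | inj₂ fv≡h = subst₂ _∈_ (sym fv≡h) (r-list v) (proj₁ h-col (r v))

    f-proper : ∀ v w → E v w → f v ≢ f w
    f-proper v w e fv≡fw with f-mix v | f-mix w
    ... | inj₁ p | inj₁ q = proj₂ g-col (r v) (r w) (r-edge e) (trans (sym p) (trans fv≡fw q))
    ... | inj₂ p | inj₂ q = proj₂ h-col (r v) (r w) (r-edge e) (trans (sym p) (trans fv≡fw q))
    ... | inj₁ p | inj₂ q =
      Step-≢-across-edge E′-irr s (r-edge e) (trans (sym p) (trans fv≡fw q))
    ... | inj₂ p | inj₁ q =
      Step-≢-across-edge E′-irr (Step-sym s) (r-edge e) (trans (sym p) (trans fv≡fw q))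

YesInstance-pullback : ∀ {n W k} {E : Fin n → Fin n → Set} {L : Fin n → Subset k}
                       {E′ : W → W → Set} {L′ : W → Subset k}
                       (r : Fin n → W) → (∀ {v w} → E v w → E′ (r v) (r w)) →
                       (∀ v → L′ (r v) ≡ L v) → (∀ x → ¬ E′ x x) →
                       ∀ {g h} → YesInstance E′ L′ g h → YesInstance E L (g ∘ r) (h ∘ r)
YesInstance-pullback r r-edge r-list E′-irr =
  YesInstance-map (_∘ r) (λ g≗h → g≗h ∘ r) λ s →
    YesInstance-of-mixtures _≟_ (allFin _) (λ v _ → ∈-allFin v)
      (λ _ → mixture-IsLColoring r r-edge r-list E′-irr s)

module _ {n k : ℕ} {E : Fin n → Fin n → Set} {L : Fin n → Subset k} (S : Subset n) where

  VertexOutside-≡ : ∀ {x y : VertexOutside S} → proj₁ x ≡ proj₁ y → x ≡ y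
  VertexOutside-≡ {v , p} {.v , q} refl = cong (v ,_) ([]=-irrelevant p q)

  IsLColoring-restrict : ∀ {g} → IsLColoring E L g →
                         IsLColoring (restrictE S E) (restrict S L) (restrict S g)
  IsLColoring-restrict (g∈L , g-proper) =
    (λ x → g∈L (proj₁ x)) , (λ x y → g-proper (proj₁ x) (proj₁ y))

  Step-restrict : ∀ {g h} → Step E L g h →
                  restrict S g ≗ restrict S h ⊎
                  Step (restrictE S E) (restrict S L) (restrict S g) (restrict S h)
  Step-restrict (g-col , h-col , v , gv≢hv , agree) with v ∈? ∁ S
  ... | yes v∈∁S = inj₂ (IsLColoring-restrict g-col , IsLColoring-restrict h-col , (v , v∈∁S) ,
                         gv≢hv , λ x x≢v → agree (proj₁ x) (x≢v ∘ VertexOutside-≡))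
  ... | no v∉∁S = inj₁ λ x → agree (proj₁ x) λ x≡v → v∉∁S (subst (_∈ ∁ S) x≡v (proj₂ x))

  YesInstance-restrict : ∀ {g h} → YesInstance E L g h →
                         YesInstance (restrictE S E) (restrict S L) (restrict S g) (restrict S h)
  YesInstance-restrict =
    YesInstance-map (restrict S) (λ g≗h → g≗h ∘ proj₁)
      ([ YesInstance-≗ , Step⇒YesInstance ]′ ∘ Step-restrict)

module Fold {n k : ℕ} {E : Fin n → Fin n → Set} (E-sym : ∀ v w → E v w → E w v)
            {L : Fin n → Subset k} {f0 ft : Fin n → Fin k} {S1 S2 : Subset n}
            (I : Identical E L f0 ft S1 S2) where

  φ : VertexIn S1 ↔ VertexIn S2
  φ = proj₁ (proj₂ I)

  φ⃗ : VertexIn S1 → Fin n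
  φ⃗ y = proj₁ (Inverse.to φ y)

  edges : ∀ x y → E (proj₁ x) (proj₁ y) ⇔ E (φ⃗ x) (φ⃗ y)
  edges = proj₁ (proj₂ (proj₂ I))

  neighbours : ∀ x w → (E (proj₁ x) w × w ∉ S1) ⇔ (E (φ⃗ x) w × w ∉ S2)
  neighbours x = proj₁ (proj₂ (proj₂ (proj₂ I)) x)

  L-φ : ∀ y → L (proj₁ y) ≡ L (φ⃗ y)
  L-φ y = proj₁ (proj₂ (proj₂ (proj₂ (proj₂ I)) y))

  f0-φ : ∀ y → f0 (proj₁ y) ≡ f0 (φ⃗ y)
  f0-φ y = proj₁ (proj₂ (proj₂ (proj₂ (proj₂ (proj₂ I)) y)))

  ft-φ : ∀ y → ft (proj₁ y) ≡ ft (φ⃗ y)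
  ft-φ y = proj₂ (proj₂ (proj₂ (proj₂ (proj₂ (proj₂ I)) y)))

  inject : VertexIn S1 → VertexOutside S2
  inject y = proj₁ y , x∉p⇒x∈∁p (proj₁ I (proj₁ y) (proj₂ y))

  fold-by : (v : Fin n) → Dec (v ∈ S2) → VertexOutside S2
  fold-by v (yes v∈S2) = inject (Inverse.from φ (v , v∈S2))
  fold-by v (no v∉S2) = v , x∉p⇒x∈∁p v∉S2

  fold : Fin n → VertexOutside S2
  fold v = fold-by v (v ∈? S2)

  data FoldView (v : Fin n) : VertexOutside S2 → Set where
    fixed    : (v∉S2 : v ∉ S2) → FoldView v (v , x∉p⇒x∈∁p v∉S2)
    mirrored : (y : VertexIn S1) → v ≡ φ⃗ y → FoldView v (inject y)

  foldView : ∀ v → FoldView v (fold v)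
  foldView v = view (v ∈? S2)
    where
    view : (d : Dec (v ∈ S2)) → FoldView v (fold-by v d)
    view (yes v∈S2) = mirrored _ (sym (cong proj₁ (Inverse.strictlyInverseˡ φ (v , v∈S2))))
    view (no v∉S2) = fixed v∉S2

  FoldView-edge : ∀ {v w x y} → FoldView v x → FoldView w y → E v w → E (proj₁ x) (proj₁ y)
  FoldView-edge (fixed _) (fixed _) e = e
  FoldView-edge {w = w} (mirrored y refl) (fixed w∉S2) e =
    proj₁ (Equivalence.from (neighbours y w) (e , w∉S2))
  FoldView-edge {v} (fixed v∉S2) (mirrored z refl) e =
    E-sym _ _ (proj₁ (Equivalence.from (neighbours z v) (E-sym _ _ e , v∉S2)))
  FoldView-edge (mirrored y refl) (mirrored z refl) e = Equivalence.from (edges y z) e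

  fold-edge : ∀ {v w} → E v w → E (proj₁ (fold v)) (proj₁ (fold w))
  fold-edge {v} {w} = FoldView-edge (foldView v) (foldView w)

  FoldView-preserves : ∀ {A : Set} (F : Fin n → A) → (∀ y → F (proj₁ y) ≡ F (φ⃗ y)) →
                       ∀ {v x} → FoldView v x → F (proj₁ x) ≡ F v
  FoldView-preserves F F-φ (fixed _) = refl
  FoldView-preserves F F-φ (mirrored y refl) = F-φ y

  fold-preserves : ∀ {A : Set} (F : Fin n → A) → (∀ y → F (proj₁ y) ≡ F (φ⃗ y)) →
                   ∀ v → F (proj₁ (fold v)) ≡ F v
  fold-preserves F F-φ v = FoldView-preserves F F-φ (foldView v)

lemma1 : (n k : ℕ) (E : Fin n → Fin n → Set)
         → (∀ v w → E v w → E w v)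
         → (∀ v → E v v → ⊥)
         → (L : Fin n → Subset k) (f0 ft : Fin n → Fin k)
         → IsLColoring E L f0 → IsLColoring E L ft
         → (S1 S2 : Subset n)
         → Identical E L f0 ft S1 S2
         → YesInstance (restrictE S2 E) (restrict S2 L) (restrict S2 f0) (restrict S2 ft)
           ⇔ YesInstance E L f0 ft
lemma1 n k E E-sym E-irr L f0 ft _ _ S1 S2 I = mk⇔ unrestrict (YesInstance-restrict S2)
  where
  open Fold E-sym I

  unrestrict : YesInstance (restrictE S2 E) (restrict S2 L) (restrict S2 f0) (restrict S2 ft) →
               YesInstance E L f0 ft
  unrestrict yes′ =
    YesInstance-trans (YesInstance-≗ (sym ∘ fold-preserves f0 f0-φ))
      (YesInstance-trans
        (YesInstance-pullback fold fold-edge (fold-preserves L L-φ) (E-irr ∘ proj₁) yes′)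
        (YesInstance-≗ (fold-preserves ft ft-φ)))
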